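{- Let $\Delta$ be a simplicial complex with vertex set $V$, and let $J\subsetneq V$ be such that $\dim(\Delta|_J)=0$. Let $i$ be an integer with $\tilde H_{i-1}(\Delta)=\tilde H_i(\Delta)=0$. Then $$\tilde H_{i-1}(\Delta|_{V\setminus J})\cong\bigoplus_{x\in J}\tilde H_{i-1}(\Delta|_{V\setminus\{x\}}).$$
   Context: For $W\subseteq V$, $\Delta|_W=\{F\in\Delta : F\subseteq W\}$ is the induced subcomplex on $W$; $\dim(\Delta|_J)=0$ means $J$ is nonempty and no two vertices of $J$ form an edge of $\Delta$. $\tilde H$ is reduced simplicial homology with coefficients in a fixed field. -}

module Defs where

open import Level using (Level; _⊔_; Lift) renaming (suc to lsuc)
open import Algebra.Bundles using (CommutativeRing)
open import Data.Bool using (Bool; true; false; T; _∧_; if_then_else_)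
open import Data.Nat as ℕ using (ℕ; zero; suc)
open import Data.Fin as Fin using (Fin; zero; suc)
open import Data.Fin.Subset using (Subset; _∈_; _⊆_; _⊂_; _∩_; _∪_; ⁅_⁆; ∣_∣; ∁; ⊤; Nonempty)
open import Data.Fin.Subset.Properties using (_⊆?_)
open import Data.Integer as ℤ using (ℤ; +_)
open import Data.Vec using (lookup; tabulate)
open import Data.Product using (Σ; _×_; _,_)
open import Relation.Nullary using (¬_; Dec; yes; no)
open import Relation.Nullary.Decidable using (⌊_⌋)
open import Relation.Binary.PropositionalEquality using (_≡_)

record Field (c ℓ : Level) : Set (lsuc (c ⊔ ℓ)) where
  field
    commutativeRing : CommutativeRing c ℓ
  open CommutativeRing commutativeRing public
  field
    1≉0     : ¬ (1# ≈ 0#)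
    inverse : ∀ x → ¬ (x ≈ 0#) → Σ Carrier (λ y → (y * x) ≈ 1#)

-- Faces are subsets of Fin n (the empty face included, as needed for
-- reduced homology); the family of faces is closed under subsets and
-- every vertex of V is a face (so V is exactly the vertex set).

record SimplicialComplex (n : ℕ) : Set where
  field
    isFace     : Subset n → Bool
    down-closed : ∀ σ τ → τ ⊆ σ → T (isFace σ) → T (isFace τ)
    vertices    : ∀ v → T (isFace ⁅ v ⁆)
open SimplicialComplex public

induced : ∀ {n} → SimplicialComplex n → Subset n → (Subset n → Bool)
induced Δ W σ = isFace Δ σ ∧ ⌊ σ ⊆? W ⌋

Dim0 : ∀ {n} → SimplicialComplex n → Subset n → Set
Dim0 Δ J = Nonempty J ×
  (∀ x y → x ∈ J → y ∈ J → ¬ (x ≡ y) → ¬ T (isFace Δ (⁅ x ⁆ ∪ ⁅ y ⁆)))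

-- Abstract "subquotient" vector spaces and linear isomorphisms.
-- A Space is a subspace (predicate In) of an ambient carrier with
-- pointwise operations, modulo an equivalence _~_.

record Space {c ℓ : Level} (K : Field c ℓ) : Set (lsuc (c ⊔ ℓ)) where
  open Field K using () renaming (Carrier to Scalar)
  field
    Carrier : Set c
    In      : Carrier → Set (c ⊔ ℓ)
    _~_     : Carrier → Carrier → Set (c ⊔ ℓ)
    _+ᵥ_    : Carrier → Carrier → Carrier
    _·ᵥ_    : Scalar → Carrier → Carrier
    0ᵥ      : Carrier

IsZeroSpace : ∀ {c ℓ} {K : Field c ℓ} → Space K → Set (c ⊔ ℓ)
IsZeroSpace A = ∀ a → In a → a ~ 0ᵥ
  where open Space A

record LinIso {c ℓ : Level} {K : Field c ℓ} (A B : Space K) : Set (c ⊔ ℓ) where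
  open Field K using () renaming (Carrier to Scalar)
  module A = Space A
  module B = Space B
  field
    f      : A.Carrier → B.Carrier
    f-in   : ∀ a → A.In a → B.In (f a)
    f-cong : ∀ a a' → A.In a → A.In a' → A._~_ a a' → B._~_ (f a) (f a')
    f-add  : ∀ a a' → A.In a → A.In a' →
             B._~_ (f (A._+ᵥ_ a a')) (B._+ᵥ_ (f a) (f a'))
    f-scal : ∀ (k : Scalar) a → A.In a → B._~_ (f (A._·ᵥ_ k a)) (B._·ᵥ_ k (f a))
    f-inj  : ∀ a a' → A.In a → A.In a' → B._~_ (f a) (f a') → A._~_ a a'
    f-surj : ∀ b → B.In b → Σ A.Carrier (λ a → A.In a × B._~_ (f a) b)

DirectSum : ∀ {c ℓ} {K : Field c ℓ} {n} → Subset n → (Fin n → Space K) → Space K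
DirectSum {K = K} {n} J H = record
  { Carrier = (x : Fin n) → Space.Carrier (H x)
  ; In      = λ g → ∀ x → x ∈ J → Space.In (H x) (g x)
  ; _~_     = λ g g' → ∀ x → x ∈ J → Space._~_ (H x) (g x) (g' x)
  ; _+ᵥ_    = λ g g' x → Space._+ᵥ_ (H x) (g x) (g' x)
  ; _·ᵥ_    = λ k g x → Space._·ᵥ_ (H x) k (g x)
  ; 0ᵥ      = λ x → Space.0ᵥ (H x)
  }

module Homology {c ℓ : Level} (K : Field c ℓ) where
  open Field K using (Carrier; _≈_; _+_; _*_; -_; _-_; 0#; 1#)

  Chain : ℕ → Set c
  Chain n = Subset n → Carrier

  sumFin : ∀ {n} → (Fin n → Carrier) → Carrier
  sumFin {zero}  g = 0#
  sumFin {suc n} g = g zero + sumFin (λ i → g (suc i))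

  signPow : ℕ → Carrier
  signPow zero    = 1#
  signPow (suc m) = - signPow m

  below : ∀ {n} → Fin n → Subset n
  below v = tabulate (λ u → ⌊ u Fin.<? v ⌋)

  -- ∂[v₀ < … < v_k] = Σ_j (-1)^j [v₀ … v̂_j … v_k]; so the coefficient
  -- of τ in ∂c is Σ_{v ∉ τ} (-1)^{#{u ∈ τ : u < v}} c(τ ∪ {v}).
  ∂ : ∀ {n} → Chain n → Chain n
  ∂ c τ = sumFin (λ v → if lookup τ v then 0#
                        else (signPow ∣ τ ∩ below v ∣ * c (τ ∪ ⁅ v ⁆)))

  -- c is a k-chain of the face family f: supported on k-dimensional faces
  -- (faces with k + 1 vertices).
  IsChain : ∀ {n} → (Subset n → Bool) → ℤ → Chain n → Set ℓ
  IsChain f k ch = ∀ σ → ¬ (T (f σ) × (+ ∣ σ ∣ ≡ k ℤ.+ ℤ.1ℤ)) → ch σ ≈ 0#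

  IsCycle : ∀ {n} → (Subset n → Bool) → ℤ → Chain n → Set ℓ
  IsCycle f k ch = IsChain f k ch × (∀ τ → ∂ ch τ ≈ 0#)

  Homologous : ∀ {n} → (Subset n → Bool) → ℤ → Chain n → Chain n → Set (c ⊔ ℓ)
  Homologous f k a b =
    Σ (Chain _) (λ d → IsChain f (k ℤ.+ ℤ.1ℤ) d × (∀ σ → (a σ - b σ) ≈ ∂ d σ))

  H̃ : ∀ {n} → (Subset n → Bool) → ℤ → Space K
  H̃ f k = record
    { Carrier = Chain _
    ; In      = λ a → Lift c (IsCycle f k a)
    ; _~_     = Homologous f k
    ; _+ᵥ_    = λ a b σ → a σ + b σ
    ; _·ᵥ_    = λ x a σ → x * a σ
    ; 0ᵥ      = λ σ → 0#
    }

-- The map sends a cycle z of Δ|_{V∖J} to the family (z)_{x ∈ J}.  The key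
-- tool is GLUING: since no face of Δ contains two vertices of J, a family
-- (G_y)_{y ∈ J} of chains of Δ glues to a single chain S that agrees with
-- G_y on every face containing y; hence ∂S agrees with ∂G_y there too.
--   * Surjectivity: fill each cycle b_x of Δ|_{V∖x} in Δ (H̃_{i-1}(Δ) = 0),
--     b_x = ∂D_x, glue the D_x to S; then ∂S lives on V∖J and
--     ∂S - b_x = ∂(S - D_x) with S - D_x a chain of Δ|_{V∖x}.
--   * Injectivity: if a - a' = ∂d_y in every Δ|_{V∖y}, fill a - a' = ∂d in Δ;
--     each d - d_y is an i-cycle of Δ, so d - d_y = ∂e_y (H̃_i(Δ) = 0); with
--     S the glued e_y, the chain d - ∂S lives on V∖J and bounds a - a'.

module Submission where

open import Defs
open import Level using (Level)
open import Data.Nat using (ℕ)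
open import Data.Fin.Subset using (Subset; _⊂_; ∁; ⁅_⁆; ⊤)
open import Data.Integer using (ℤ; _-_; 1ℤ)

open import Level using (_⊔_; lift; lower)
open import Data.Nat using (zero; suc)
open import Data.Fin using (Fin; zero; suc; _<_; _<?_)
import Data.Fin.Properties as Finₚ
open import Data.Fin.Subset using (_∈_; _∉_; _⊆_; _∪_; _∩_; ∣_∣) renaming (⊥ to ∅)
open import Data.Fin.Subset.Properties
  using (_∈?_; _⊆?_; x∈⁅x⁆; x∈⁅y⁆⇒x≡y; x∈p∪q⁺; x∈p∪q⁻; x∈p∩q⁻; p⊆p∪q; ∪-assoc; ∪-comm;
         ∪-identityʳ; ∩-zeroˡ; ∩-distribʳ-∪; x∉∁p⇒x∈p; x∈p⇒x∉∁p; p⊆q⇒∁p⊇∁q)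
open import Data.Integer using (+_; -1ℤ) renaming (_+_ to _+ℤ_)
import Data.Integer.Properties as ℤₚ
open import Data.Bool using (Bool; true; false; T; if_then_else_)
open import Data.Bool.Properties using (T-∧)
open import Data.Vec using (_∷_; lookup; here; there)
open import Data.Vec.Properties using ([]=⇒lookup; lookup⇒[]=; lookup∘tabulate)
open import Data.Product using (Σ; _×_; _,_; proj₁; proj₂)
open import Data.Sum using (inj₁; inj₂)
open import Data.Empty using (⊥-elim)
open import Function using (_∘_)
open import Function.Bundles using (Equivalence)
open import Relation.Nullary using (¬_; Dec; yes; no)
open import Relation.Nullary.Decidable
  using (⌊_⌋; _×-dec_; ¬?; toWitness; fromWitness; isYes≗does; dec-true; dec-false; decidable-stable)
open import Relation.Binary.Definitions using (tri<; tri≈; tri>)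
open import Relation.Binary.PropositionalEquality as ≡ using (_≡_; _≢_; cong; subst)
import Algebra.Properties.Ring as RingProperties
import Algebra.Properties.CommutativeSemigroup as CommutativeSemigroupProperties
import Algebra.Properties.AbelianGroup as AbelianGroupProperties

module _ {n : ℕ} where

  lookup⇒∉ : ∀ {p : Subset n} {x} → lookup p x ≡ false → x ∉ p
  lookup⇒∉ p[x]≡false x∈p with ≡.trans (≡.sym ([]=⇒lookup x∈p)) p[x]≡false
  ... | ()

  ∉⇒lookup : ∀ {p : Subset n} {x} → x ∉ p → lookup p x ≡ false
  ∉⇒lookup {p} {x} x∉p with lookup p x in p[x]
  ... | true  = ⊥-elim (x∉p (lookup⇒[]= x p p[x]))
  ... | false = ≡.refl

  outside-vertex : ∀ (σ W : Subset n) → ¬ σ ⊆ W → Σ (Fin n) (λ v → v ∈ σ × v ∉ W)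
  outside-vertex σ W σ⊈W with Finₚ.any? (λ v → v ∈? σ ×-dec ¬? (v ∈? W))
  ... | yes witness = witness
  ... | no none = ⊥-elim (σ⊈W (λ {v} v∈σ →
          decidable-stable (v ∈? W) (λ v∉W → none (v , v∈σ , v∉W))))

  ∈-insert : ∀ {τ : Subset n} {v} w → v ∈ τ → v ∈ τ ∪ ⁅ w ⁆
  ∈-insert w v∈τ = x∈p∪q⁺ (inj₁ v∈τ)

  ∈-insert-self : ∀ (τ : Subset n) w → w ∈ τ ∪ ⁅ w ⁆
  ∈-insert-self τ w = x∈p∪q⁺ (inj₂ (x∈⁅x⁆ w))

  ∉-insert : ∀ {τ : Subset n} {v w} → v ∉ τ → v ≢ w → v ∉ τ ∪ ⁅ w ⁆
  ∉-insert {τ} {w = w} v∉τ v≢w v∈τ∪w with x∈p∪q⁻ τ ⁅ w ⁆ v∈τ∪w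
  ... | inj₁ v∈τ  = v∉τ v∈τ
  ... | inj₂ v∈⁅w⁆ = v≢w (x∈⁅y⁆⇒x≡y w v∈⁅w⁆)

  insert-comm : ∀ (τ : Subset n) w v → (τ ∪ ⁅ w ⁆) ∪ ⁅ v ⁆ ≡ (τ ∪ ⁅ v ⁆) ∪ ⁅ w ⁆
  insert-comm τ w v = begin
    (τ ∪ ⁅ w ⁆) ∪ ⁅ v ⁆ ≡⟨ ∪-assoc τ ⁅ w ⁆ ⁅ v ⁆ ⟩
    τ ∪ (⁅ w ⁆ ∪ ⁅ v ⁆) ≡⟨ cong (τ ∪_) (∪-comm ⁅ w ⁆ ⁅ v ⁆) ⟩
    τ ∪ (⁅ v ⁆ ∪ ⁅ w ⁆) ≡⟨ ≡.sym (∪-assoc τ ⁅ v ⁆ ⁅ w ⁆) ⟩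
    (τ ∪ ⁅ v ⁆) ∪ ⁅ w ⁆ ∎
    where open ≡.≡-Reasoning

∣insert∣ : ∀ {n} {τ : Subset n} w → w ∉ τ → ∣ τ ∪ ⁅ w ⁆ ∣ ≡ suc ∣ τ ∣
∣insert∣ {τ = true  ∷ τ} zero    w∉τ = ⊥-elim (w∉τ here)
∣insert∣ {τ = false ∷ τ} zero    w∉τ = cong (suc ∘ ∣_∣) (∪-identityʳ τ)
∣insert∣ {τ = true  ∷ τ} (suc w) w∉τ = cong suc (∣insert∣ w (w∉τ ∘ there))
∣insert∣ {τ = false ∷ τ} (suc w) w∉τ = ∣insert∣ w (w∉τ ∘ there)

⁅⁆∩-∈ : ∀ {n} (w : Fin n) {b} → w ∈ b → ⁅ w ⁆ ∩ b ≡ ⁅ w ⁆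
⁅⁆∩-∈ zero    {true ∷ b} here       = cong (true ∷_) (∩-zeroˡ b)
⁅⁆∩-∈ (suc w) {_ ∷ b}   (there w∈b) = cong (false ∷_) (⁅⁆∩-∈ w w∈b)

⁅⁆∩-∉ : ∀ {n} (w : Fin n) {b} → w ∉ b → ⁅ w ⁆ ∩ b ≡ ∅
⁅⁆∩-∉ zero    {true  ∷ b} w∉b = ⊥-elim (w∉b here)
⁅⁆∩-∉ zero    {false ∷ b} w∉b = cong (false ∷_) (∩-zeroˡ b)
⁅⁆∩-∉ (suc w) {_ ∷ b}     w∉b = cong (false ∷_) (⁅⁆∩-∉ w (w∉b ∘ there))

∣insert∩∣-∈ : ∀ {n} {τ b : Subset n} w → w ∉ τ → w ∈ b → ∣ (τ ∪ ⁅ w ⁆) ∩ b ∣ ≡ suc ∣ τ ∩ b ∣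
∣insert∩∣-∈ {τ = τ} {b} w w∉τ w∈b = begin
  ∣ (τ ∪ ⁅ w ⁆) ∩ b ∣         ≡⟨ cong ∣_∣ (∩-distribʳ-∪ b τ ⁅ w ⁆) ⟩
  ∣ (τ ∩ b) ∪ (⁅ w ⁆ ∩ b) ∣   ≡⟨ cong (λ s → ∣ (τ ∩ b) ∪ s ∣) (⁅⁆∩-∈ w w∈b) ⟩
  ∣ (τ ∩ b) ∪ ⁅ w ⁆ ∣         ≡⟨ ∣insert∣ w (w∉τ ∘ proj₁ ∘ x∈p∩q⁻ τ b) ⟩
  suc ∣ τ ∩ b ∣               ∎
  where open ≡.≡-Reasoning

insert∩-∉ : ∀ {n} (τ b : Subset n) w → w ∉ b → (τ ∪ ⁅ w ⁆) ∩ b ≡ τ ∩ b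
insert∩-∉ τ b w w∉b = begin
  (τ ∪ ⁅ w ⁆) ∩ b         ≡⟨ ∩-distribʳ-∪ b τ ⁅ w ⁆ ⟩
  (τ ∩ b) ∪ (⁅ w ⁆ ∩ b)   ≡⟨ cong ((τ ∩ b) ∪_) (⁅⁆∩-∉ w w∉b) ⟩
  (τ ∩ b) ∪ ∅             ≡⟨ ∪-identityʳ (τ ∩ b) ⟩
  τ ∩ b                   ∎
  where open ≡.≡-Reasoning

⁅⁆⊆ : ∀ {n} {p : Subset n} {x} → x ∈ p → ⁅ x ⁆ ⊆ p
⁅⁆⊆ {p = p} {x} x∈p u∈⁅x⁆ = subst (_∈ p) (≡.sym (x∈⁅y⁆⇒x≡y x u∈⁅x⁆)) x∈p

∁-antitone : ∀ {n} {J : Subset n} {x} → x ∈ J → ∁ J ⊆ ∁ ⁅ x ⁆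
∁-antitone x∈J = p⊆q⇒∁p⊇∁q (⁅⁆⊆ x∈J)

∉∁⁅⁆ : ∀ {n} {x v : Fin n} → v ∉ ∁ ⁅ x ⁆ → v ≡ x
∉∁⁅⁆ {x = x} v∉ = x∈⁅y⁆⇒x≡y x (x∉∁p⇒x∈p v∉)

x∉∁⁅x⁆ : ∀ {n} (x : Fin n) → x ∉ ∁ ⁅ x ⁆
x∉∁⁅x⁆ x = x∈p⇒x∉∁p (x∈⁅x⁆ x)

pred-suc : ∀ j → (j - 1ℤ) +ℤ 1ℤ ≡ j
pred-suc j = ≡.trans (ℤₚ.+-assoc j -1ℤ 1ℤ) (ℤₚ.+-identityʳ j)

+1-injective : ∀ {j k} → j +ℤ 1ℤ ≡ k +ℤ 1ℤ → j ≡ k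
+1-injective {j} {k} = AbelianGroupProperties.∙-cancelʳ ℤₚ.+-0-abelianGroup 1ℤ j k

size-insert-degree : ∀ {n} {σ : Subset n} {v m} → v ∉ σ →
  + ∣ σ ∪ ⁅ v ⁆ ∣ ≡ (m +ℤ 1ℤ) +ℤ 1ℤ → + ∣ σ ∣ ≡ m +ℤ 1ℤ
size-insert-degree {σ = σ} {v} {m} v∉σ size = +1-injective (begin
  + ∣ σ ∣ +ℤ 1ℤ         ≡⟨ ℤₚ.+-comm (+ ∣ σ ∣) 1ℤ ⟩
  + suc ∣ σ ∣            ≡⟨ cong +_ (≡.sym (∣insert∣ v v∉σ)) ⟩
  + ∣ σ ∪ ⁅ v ⁆ ∣        ≡⟨ size ⟩
  (m +ℤ 1ℤ) +ℤ 1ℤ        ∎)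
  where open ≡.≡-Reasoning

module FiniteSums {c ℓ : Level} (K : Field c ℓ) where
  open Field K hiding (zero) renaming (_-_ to _⊖_)
  open Homology K using (sumFin)
  open RingProperties ring using (-‿+-comm; -0#≈0#; -‿involutive)
  open CommutativeSemigroupProperties +-commutativeSemigroup using (interchange)
  open import Relation.Binary.Reasoning.Setoid setoid

  ⊖-cong : ∀ {a a' b b'} → a ≈ a' → b ≈ b' → a ⊖ b ≈ a' ⊖ b'
  ⊖-cong a≈a' b≈b' = +-cong a≈a' (-‿cong b≈b')

  x⊖0≈x : ∀ x → x ⊖ 0# ≈ x
  x⊖0≈x x = trans (+-congˡ -0#≈0#) (+-identityʳ x)

  x⊖x≈0 : ∀ x → x ⊖ x ≈ 0#
  x⊖x≈0 = -‿inverseʳ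

  x⊖[x⊖y]≈y : ∀ x y → x ⊖ (x ⊖ y) ≈ y
  x⊖[x⊖y]≈y x y = begin
    x + - (x + - y)     ≈⟨ +-congˡ (sym (-‿+-comm x (- y))) ⟩
    x + (- x + - - y)   ≈⟨ sym (+-assoc x (- x) (- - y)) ⟩
    (x + - x) + - - y   ≈⟨ +-cong (-‿inverseʳ x) (-‿involutive y) ⟩
    0# + y              ≈⟨ +-identityˡ y ⟩
    y                   ∎

  ⊖-interchange : ∀ a b a' b' → (a + b) ⊖ (a' + b') ≈ (a ⊖ a') + (b ⊖ b')
  ⊖-interchange a b a' b' = begin
    (a + b) + - (a' + b')    ≈⟨ +-congˡ (sym (-‿+-comm a' b')) ⟩
    (a + b) + (- a' + - b')  ≈⟨ interchange a b (- a') (- b') ⟩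
    (a ⊖ a') + (b ⊖ b')      ∎

  sum-cong : ∀ {n} {g h : Fin n → Carrier} → (∀ i → g i ≈ h i) → sumFin g ≈ sumFin h
  sum-cong {zero}  g≈h = refl
  sum-cong {suc n} g≈h = +-cong (g≈h zero) (sum-cong (g≈h ∘ suc))

  sum-zero : ∀ {n} {g : Fin n → Carrier} → (∀ i → g i ≈ 0#) → sumFin g ≈ 0#
  sum-zero {zero}  g≈0 = refl
  sum-zero {suc n} g≈0 = trans (+-cong (g≈0 zero) (sum-zero (g≈0 ∘ suc))) (+-identityʳ 0#)

  sum-add : ∀ {n} (g h : Fin n → Carrier) → sumFin (λ i → g i + h i) ≈ sumFin g + sumFin h
  sum-add {zero}  g h = sym (+-identityʳ 0#)
  sum-add {suc n} g h =
    trans (+-congˡ (sum-add (g ∘ suc) (h ∘ suc))) (interchange (g zero) (h zero) _ _)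

  sum-sub : ∀ {n} (g h : Fin n → Carrier) → sumFin (λ i → g i ⊖ h i) ≈ sumFin g ⊖ sumFin h
  sum-sub {zero}  g h = sym (x⊖0≈x 0#)
  sum-sub {suc n} g h =
    trans (+-congˡ (sum-sub (g ∘ suc) (h ∘ suc))) (sym (⊖-interchange (g zero) _ (h zero) _))

  sum-scale : ∀ {n} (k : Carrier) (g : Fin n → Carrier) → sumFin (λ i → k * g i) ≈ k * sumFin g
  sum-scale {zero}  k g = sym (zeroʳ k)
  sum-scale {suc n} k g = trans (+-congˡ (sum-scale k (g ∘ suc))) (sym (distribˡ k _ _))

  sum-single : ∀ {n} (g : Fin n → Carrier) y → (∀ x → x ≢ y → g x ≈ 0#) → sumFin g ≈ g y
  sum-single g zero others =
    trans (+-congˡ (sum-zero (λ i → others (suc i) (λ ())))) (+-identityʳ _)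
  sum-single g (suc y) others =
    trans (+-cong (others zero (λ ())) (sum-single (g ∘ suc) y (λ x x≢y → others (suc x) (x≢y ∘ Finₚ.suc-injective))))
          (+-identityˡ _)

  -- The double sum of an antisymmetric array (zero diagonal, T v w = - T w v)
  -- vanishes; this holds in every characteristic, including 2.
  sum-antisym : ∀ {n} (T : Fin n → Fin n → Carrier) → (∀ v → T v v ≈ 0#) →
    (∀ v w → T v w + T w v ≈ 0#) → sumFin (λ v → sumFin (T v)) ≈ 0#
  sum-antisym {zero}  T diag anti = refl
  sum-antisym {suc n} T diag anti = begin
    (T zero zero + row) + sumFin (λ v → T (suc v) zero + sumFin (λ w → T (suc v) (suc w)))
      ≈⟨ +-congˡ (sum-add (λ v → T (suc v) zero) _) ⟩
    (T zero zero + row) + (column + rest)  ≈⟨ interchange _ _ _ _ ⟩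
    (T zero zero + column) + (row + rest)
      ≈⟨ +-cong (trans (+-congʳ (diag zero)) (+-identityˡ _)) (trans (+-congˡ rest≈0) (+-identityʳ row)) ⟩
    column + row                           ≈⟨ +-comm column row ⟩
    row + column                           ≈⟨ sym (sum-add (λ w → T zero (suc w)) (λ v → T (suc v) zero)) ⟩
    sumFin (λ w → T zero (suc w) + T (suc w) zero) ≈⟨ sum-zero (anti zero ∘ suc) ⟩
    0#                                     ∎
    where
    row column rest : Carrier
    row    = sumFin (λ w → T zero (suc w))
    column = sumFin (λ v → T (suc v) zero)
    rest   = sumFin (λ v → sumFin (λ w → T (suc v) (suc w)))
    rest≈0 : rest ≈ 0#
    rest≈0 = sum-antisym (λ v w → T (suc v) (suc w)) (diag ∘ suc) (λ v w → anti (suc v) (suc w))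

module Boundary {c ℓ : Level} (K : Field c ℓ) where
  open Field K hiding (zero) renaming (_-_ to _⊖_)
  open Homology K
  open FiniteSums K
  open RingProperties ring using (-‿distribʳ-*; x[y-z]≈xy-xz)
  open import Relation.Binary.Reasoning.Setoid setoid

  -- The sign (-1)^{#{u ∈ τ : u < v}} with which τ is a facet of τ ∪ {v}.
  sign : ∀ {n} → Subset n → Fin n → Carrier
  sign τ v = signPow ∣ τ ∩ below v ∣

  facet : ∀ {n} → Subset n → Fin n → Carrier → Carrier
  facet τ v x = if lookup τ v then 0# else sign τ v * x

  facet-∈ : ∀ {n} {τ : Subset n} {v} x → v ∈ τ → facet τ v x ≡ 0#
  facet-∈ x v∈τ rewrite []=⇒lookup v∈τ = ≡.refl

  facet-∉ : ∀ {n} {τ : Subset n} {v} x → v ∉ τ → facet τ v x ≡ sign τ v * x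
  facet-∉ x v∉τ rewrite ∉⇒lookup v∉τ = ≡.refl

  facet-cong : ∀ {n} (τ : Subset n) v {x y} → (v ∉ τ → x ≈ y) → facet τ v x ≈ facet τ v y
  facet-cong τ v x≈y with lookup τ v in τ[v]
  ... | true  = refl
  ... | false = *-congˡ (x≈y (lookup⇒∉ τ[v]))

  facet-zero : ∀ {n} (τ : Subset n) v → facet τ v 0# ≈ 0#
  facet-zero τ v with lookup τ v
  ... | true  = refl
  ... | false = zeroʳ _

  facet-sub : ∀ {n} (τ : Subset n) v x y → facet τ v (x ⊖ y) ≈ facet τ v x ⊖ facet τ v y
  facet-sub τ v x y with lookup τ v
  ... | true  = sym (x⊖0≈x 0#)
  ... | false = x[y-z]≈xy-xz _ x y

  facet-sum : ∀ {m n} (τ : Subset n) v (g : Fin m → Carrier) →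
    facet τ v (sumFin g) ≈ sumFin (λ u → facet τ v (g u))
  facet-sum {m} τ v g with lookup τ v
  ... | true  = sym (sum-zero {m} {λ _ → 0#} (λ _ → refl))
  ... | false = sym (sum-scale _ g)

  ∂-local : ∀ {n} (a b : Chain n) τ →
    (∀ v → v ∉ τ → a (τ ∪ ⁅ v ⁆) ≈ b (τ ∪ ⁅ v ⁆)) → ∂ a τ ≈ ∂ b τ
  ∂-local a b τ a≈b = sum-cong (λ v → facet-cong τ v (a≈b v))

  ∂-sub : ∀ {n} (a b : Chain n) τ → ∂ (λ σ → a σ ⊖ b σ) τ ≈ ∂ a τ ⊖ ∂ b τ
  ∂-sub a b τ = trans (sum-cong (λ v → facet-sub τ v (a (τ ∪ ⁅ v ⁆)) (b (τ ∪ ⁅ v ⁆))))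
                      (sum-sub (λ v → facet τ v (a (τ ∪ ⁅ v ⁆))) (λ v → facet τ v (b (τ ∪ ⁅ v ⁆))))

  ∂-zero : ∀ {n} (a : Chain n) τ → (∀ σ → a σ ≈ 0#) → ∂ a τ ≈ 0#
  ∂-zero a τ a≈0 = sum-zero (λ v → trans (facet-cong τ v (λ _ → a≈0 (τ ∪ ⁅ v ⁆))) (facet-zero τ v))

  below-∈ : ∀ {n} {w v : Fin n} → w < v → w ∈ below v
  below-∈ {w = w} {v} w<v = lookup⇒[]= w (below v) (≡.trans (lookup∘tabulate _ w) (≡.trans (isYes≗does (w <? v)) (dec-true (w <? v) w<v)))

  below-∉ : ∀ {n} {w v : Fin n} → ¬ w < v → w ∉ below v
  below-∉ {w = w} {v} w≮v = lookup⇒∉ (≡.trans (lookup∘tabulate _ w) (≡.trans (isYes≗does (w <? v)) (dec-false (w <? v) w≮v)))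

  sign-insert-below : ∀ {n} {τ : Subset n} {w v} → w ∉ τ → w < v → sign (τ ∪ ⁅ w ⁆) v ≡ - sign τ v
  sign-insert-below w∉τ w<v = cong signPow (∣insert∩∣-∈ _ w∉τ (below-∈ w<v))

  sign-insert-above : ∀ {n} {τ : Subset n} {w v} → ¬ w < v → sign (τ ∪ ⁅ w ⁆) v ≡ sign τ v
  sign-insert-above {τ = τ} {w} {v} w≮v = cong (signPow ∘ ∣_∣) (insert∩-∉ τ (below v) w (below-∉ w≮v))

  cross-cancel : ∀ a b → a * - b + b * a ≈ 0#
  cross-cancel a b = begin
    a * - b + b * a       ≈⟨ +-cong (sym (-‿distribʳ-* a b)) (*-comm b a) ⟩
    - (a * b) + a * b     ≈⟨ -‿inverseˡ (a * b) ⟩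
    0#                    ∎

  sign-antisym : ∀ {n} {τ : Subset n} {w v} → w ∉ τ → v ∉ τ → w ≢ v →
    sign τ w * sign (τ ∪ ⁅ w ⁆) v + sign τ v * sign (τ ∪ ⁅ v ⁆) w ≈ 0#
  sign-antisym {τ = τ} {w} {v} w∉τ v∉τ w≢v with Finₚ.<-cmp w v
  ... | tri< w<v _ v≮w
    rewrite sign-insert-below {τ = τ} w∉τ w<v | sign-insert-above {τ = τ} {v} v≮w = cross-cancel _ _
  ... | tri≈ _ w≡v _ = ⊥-elim (w≢v w≡v)
  ... | tri> w≮v _ v<w
    rewrite sign-insert-below {τ = τ} v∉τ v<w | sign-insert-above {τ = τ} {w} w≮v =
      trans (+-comm _ _) (cross-cancel _ _)

  ∂∂≈0 : ∀ {n} (c : Chain n) τ → ∂ (∂ c) τ ≈ 0#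
  ∂∂≈0 {n} c τ = trans (sum-cong (λ w → facet-sum τ w (λ v → facet (τ ∪ ⁅ w ⁆) v (c ((τ ∪ ⁅ w ⁆) ∪ ⁅ v ⁆)))))
                   (sum-antisym term term-diag term-anti)
    where
    -- the coefficient of c (τ ∪ {w} ∪ {v}) in ∂ (∂ c) τ, reached via τ ∪ {w}
    term : Fin n → Fin n → Carrier
    term w v = facet τ w (facet (τ ∪ ⁅ w ⁆) v (c ((τ ∪ ⁅ w ⁆) ∪ ⁅ v ⁆)))

    term-diag : ∀ w → term w w ≈ 0#
    term-diag w = trans (facet-cong τ w (λ _ → reflexive (facet-∈ _ (∈-insert-self τ w)))) (facet-zero τ w)

    term-value : ∀ {w v} → w ∉ τ → v ∉ τ → w ≢ v →
      term w v ≈ (sign τ w * sign (τ ∪ ⁅ w ⁆) v) * c ((τ ∪ ⁅ w ⁆) ∪ ⁅ v ⁆)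
    term-value {w} {v} w∉τ v∉τ w≢v
      rewrite facet-∉ (c ((τ ∪ ⁅ w ⁆) ∪ ⁅ v ⁆)) (∉-insert v∉τ (≡.≢-sym w≢v))
            | facet-∉ (sign (τ ∪ ⁅ w ⁆) v * c ((τ ∪ ⁅ w ⁆) ∪ ⁅ v ⁆)) w∉τ = sym (*-assoc _ _ _)

    term-anti : ∀ w v → term w v + term v w ≈ 0#
    term-anti w v with w ∈? τ | v ∈? τ | w Finₚ.≟ v
    ... | yes w∈τ | _ | _ = trans (+-cong (reflexive (facet-∈ _ w∈τ))
          (trans (facet-cong τ v (λ _ → reflexive (facet-∈ _ (∈-insert v w∈τ)))) (facet-zero τ v))) (+-identityʳ 0#)
    ... | no _ | yes v∈τ | _ = trans (+-cong
          (trans (facet-cong τ w (λ _ → reflexive (facet-∈ _ (∈-insert w v∈τ)))) (facet-zero τ w))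
          (reflexive (facet-∈ _ v∈τ))) (+-identityʳ 0#)
    ... | no _ | no _ | yes ≡.refl = trans (+-cong (term-diag w) (term-diag w)) (+-identityʳ 0#)
    ... | no w∉τ | no v∉τ | no w≢v = begin
      term w v + term v w
        ≈⟨ +-cong (term-value w∉τ v∉τ w≢v) (term-value v∉τ w∉τ (≡.≢-sym w≢v)) ⟩
      (sign τ w * sign (τ ∪ ⁅ w ⁆) v) * C + (sign τ v * sign (τ ∪ ⁅ v ⁆) w) * c ((τ ∪ ⁅ v ⁆) ∪ ⁅ w ⁆)
        ≈⟨ +-congˡ (*-congˡ (reflexive (cong c (insert-comm τ v w)))) ⟩
      (sign τ w * sign (τ ∪ ⁅ w ⁆) v) * C + (sign τ v * sign (τ ∪ ⁅ v ⁆) w) * C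
        ≈⟨ sym (distribʳ C _ _) ⟩
      (sign τ w * sign (τ ∪ ⁅ w ⁆) v + sign τ v * sign (τ ∪ ⁅ v ⁆) w) * C
        ≈⟨ *-congʳ (sign-antisym w∉τ v∉τ w≢v) ⟩
      0# * C ≈⟨ zeroˡ C ⟩
      0# ∎
      where
      C : Carrier
      C = c ((τ ∪ ⁅ w ⁆) ∪ ⁅ v ⁆)

_⊑_ : ∀ {n} → (Subset n → Bool) → (Subset n → Bool) → Set
f ⊑ g = ∀ σ → T (f σ) → T (g σ)

module InducedSubcomplex {n : ℕ} (Δ : SimplicialComplex n) where

  induced⇒face : ∀ {W} σ → T (induced Δ W σ) → T (isFace Δ σ)
  induced⇒face {W} σ = proj₁ ∘ Equivalence.to (T-∧ {isFace Δ σ} {⌊ σ ⊆? W ⌋})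

  induced⇒⊆ : ∀ {W} σ → T (induced Δ W σ) → σ ⊆ W
  induced⇒⊆ {W} σ = toWitness ∘ proj₂ ∘ Equivalence.to (T-∧ {isFace Δ σ} {⌊ σ ⊆? W ⌋})

  face⇒induced : ∀ {W} σ → T (isFace Δ σ) → σ ⊆ W → T (induced Δ W σ)
  face⇒induced {W} σ σ∈Δ σ⊆W =
    Equivalence.from (T-∧ {isFace Δ σ} {⌊ σ ⊆? W ⌋}) (σ∈Δ , fromWitness (λ {x} → σ⊆W {x}))

  induced-mono : ∀ {W W'} → W ⊆ W' → induced Δ W ⊑ induced Δ W'
  induced-mono W⊆W' σ σ∈Δ|W =
    face⇒induced σ (induced⇒face σ σ∈Δ|W) (W⊆W' ∘ induced⇒⊆ σ σ∈Δ|W)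

  isolated : ∀ {J ρ x y} → Dim0 Δ J → T (isFace Δ ρ) →
    x ∈ J → y ∈ J → x ∈ ρ → y ∈ ρ → x ≡ y
  isolated {J} {ρ} {x} {y} (_ , no-edge) ρ∈Δ x∈J y∈J x∈ρ y∈ρ with x Finₚ.≟ y
  ... | yes x≡y = x≡y
  ... | no x≢y  = ⊥-elim (no-edge x y x∈J y∈J x≢y (down-closed Δ ρ (⁅ x ⁆ ∪ ⁅ y ⁆) edge⊆ρ ρ∈Δ))
    where
    edge⊆ρ : ⁅ x ⁆ ∪ ⁅ y ⁆ ⊆ ρ
    edge⊆ρ u∈edge with x∈p∪q⁻ ⁅ x ⁆ ⁅ y ⁆ u∈edge
    ... | inj₁ u∈⁅x⁆ = ⁅⁆⊆ x∈ρ u∈⁅x⁆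
    ... | inj₂ u∈⁅y⁆ = ⁅⁆⊆ y∈ρ u∈⁅y⁆

module _ {a p} {A : Set a} {n : ℕ} {P : Fin n → A → Set p} (J : Subset n) (default : A)
         (exists : ∀ y → y ∈ J → Σ A (P y)) where

  choose : Fin n → A
  choose y with y ∈? J
  ... | yes y∈J = proj₁ (exists y y∈J)
  ... | no _    = default

  choose-spec : ∀ y → y ∈ J → P y (choose y)
  choose-spec y y∈J with y ∈? J
  ... | yes y∈J' = proj₂ (exists y y∈J')
  ... | no y∉J   = ⊥-elim (y∉J y∈J)

module Chains {c ℓ : Level} (K : Field c ℓ) where
  open Field K hiding (zero) renaming (_-_ to _⊖_)
  open Homology K
  open FiniteSums K
  open Boundary K

  chain-mono : ∀ {n} {f g : Subset n → Bool} m {a} → f ⊑ g → IsChain f m a → IsChain g m a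
  chain-mono m f⊑g a-chain σ not-g-face = a-chain σ (λ (σ∈f , size) → not-g-face (f⊑g σ σ∈f , size))

  cycle-mono : ∀ {n} {f g : Subset n → Bool} m {a} → f ⊑ g → IsCycle f m a → IsCycle g m a
  cycle-mono m f⊑g (a-chain , ∂a≈0) = chain-mono m f⊑g a-chain , ∂a≈0

  homologous-mono : ∀ {n} {f g : Subset n → Bool} m {a b} → f ⊑ g →
    Homologous f m a b → Homologous g m a b
  homologous-mono m f⊑g (d , d-chain , a-b≈∂d) = d , chain-mono (m +ℤ 1ℤ) f⊑g d-chain , a-b≈∂d

  chain-sub : ∀ {n} {f : Subset n → Bool} m {a b} →
    IsChain f m a → IsChain f m b → IsChain f m (λ σ → a σ ⊖ b σ)
  chain-sub m a-chain b-chain σ not-face =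
    trans (⊖-cong (a-chain σ not-face) (b-chain σ not-face)) (x⊖0≈x 0#)

  homologous-refl : ∀ {n} {f : Subset n → Bool} m (a : Chain n) → Homologous f m a a
  homologous-refl m a =
    (λ _ → 0#) , (λ _ _ → refl) , (λ σ → trans (x⊖x≈0 (a σ)) (sym (∂-zero (λ _ → 0#) σ (λ _ → refl))))

  -- The boundary of an (m+1)-chain of a simplicial complex is an m-chain:
  -- a facet of a face is a face, one dimension lower.
  ∂-chain : ∀ {n} (Δ : SimplicialComplex n) m {d} →
    IsChain (isFace Δ) (m +ℤ 1ℤ) d → IsChain (isFace Δ) m (∂ d)
  ∂-chain Δ m {d} d-chain σ not-face =
    sum-zero (λ v → trans (facet-cong σ v (cofacet-vanishes v)) (facet-zero σ v))
    where
    cofacet-vanishes : ∀ v → v ∉ σ → d (σ ∪ ⁅ v ⁆) ≈ 0#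
    cofacet-vanishes v v∉σ = d-chain (σ ∪ ⁅ v ⁆) (λ (σv∈Δ , size) →
      not-face (down-closed Δ (σ ∪ ⁅ v ⁆) σ (p⊆p∪q ⁅ v ⁆) σv∈Δ , size-insert-degree {m = m} v∉σ size))

  Filling : ∀ {n} → (Subset n → Bool) → ℤ → Chain n → Chain n → Set ℓ
  Filling f m z d = IsChain f (m +ℤ 1ℤ) d × (∀ σ → ∂ d σ ≈ z σ)

  fill : ∀ {n} {f : Subset n → Bool} m {z} →
    IsZeroSpace (H̃ f m) → IsCycle f m z → Σ (Chain n) (Filling f m z)
  fill m {z} H̃≈0 z-cycle with H̃≈0 z (lift z-cycle)
  ... | d , d-chain , z-0≈∂d = d , d-chain , (λ σ → trans (sym (z-0≈∂d σ)) (x⊖0≈x (z σ)))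

  module _ {n : ℕ} (Δ : SimplicialComplex n) where
    open InducedSubcomplex Δ

    vanish-outside : ∀ {W} m {a σ v} → IsChain (induced Δ W) m a → v ∈ σ → v ∉ W → a σ ≈ 0#
    vanish-outside m {σ = σ} a-chain v∈σ v∉W =
      a-chain σ (λ (σ∈Δ|W , _) → v∉W (induced⇒⊆ σ σ∈Δ|W v∈σ))

    restrict : ∀ {W} m {a} → IsChain (isFace Δ) m a →
      (∀ σ v → v ∈ σ → v ∉ W → a σ ≈ 0#) → IsChain (induced Δ W) m a
    restrict {W} m {a} a-chain vanishes σ not-face = by-inclusion (σ ⊆? W)
      where
      by-inclusion : Dec (σ ⊆ W) → a σ ≈ 0#
      by-inclusion (yes σ⊆W) = a-chain σ (λ (σ∈Δ , size) → not-face (face⇒induced σ σ∈Δ σ⊆W , size))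
      by-inclusion (no σ⊈W) with outside-vertex σ W σ⊈W
      ... | v , v∈σ , v∉W = vanishes σ v v∈σ v∉W

-- Gluing: when no face of Δ contains two vertices of J, chains G_y
-- (y ∈ J) of Δ combine into one chain agreeing with G_y near y.

module Gluing {c ℓ : Level} (K : Field c ℓ) {n : ℕ} (Δ : SimplicialComplex n) (J : Subset n)
              (dim0 : Dim0 Δ J) where
  open Field K hiding (zero) renaming (_-_ to _⊖_)
  open Homology K
  open FiniteSums K
  open Boundary K
  open InducedSubcomplex Δ

  when : ∀ {A : Set} → Dec A → Carrier → Carrier
  when (yes _) x = x
  when (no _)  _ = 0#

  -- glue G ρ = Σ_{x ∈ J ∩ ρ} G x ρ, which is G y ρ for the vertex y of J in
  -- ρ whenever ρ is a face.
  glue : (Fin n → Chain n) → Chain n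
  glue G ρ = sumFin (λ x → when (x ∈? J ×-dec x ∈? ρ) (G x ρ))

  module _ (m : ℤ) {G : Fin n → Chain n} (G-chain : ∀ y → y ∈ J → IsChain (isFace Δ) m (G y)) where

    glue-chain : IsChain (isFace Δ) m (glue G)
    glue-chain ρ not-face = sum-zero (λ x → summand-vanishes (x ∈? J ×-dec x ∈? ρ))
      where
      summand-vanishes : ∀ {x} (x∈J∩ρ? : Dec (x ∈ J × x ∈ ρ)) → when x∈J∩ρ? (G x ρ) ≈ 0#
      summand-vanishes (yes (x∈J , _)) = G-chain _ x∈J ρ not-face
      summand-vanishes (no _)          = refl

    -- The other summands vanish: on a face ρ ∋ y no other vertex of J
    -- lies in ρ, and on a non-face every G x is zero.
    glue-at : ∀ {y ρ} → y ∈ J → y ∈ ρ → glue G ρ ≈ G y ρ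
    glue-at {y} {ρ} y∈J y∈ρ =
      trans (sum-single (λ x → when (x ∈? J ×-dec x ∈? ρ) (G x ρ)) y other-summand)
            (selected (y ∈? J ×-dec y ∈? ρ))
      where
      selected : (y∈J∩ρ? : Dec (y ∈ J × y ∈ ρ)) → when y∈J∩ρ? (G y ρ) ≈ G y ρ
      selected (yes _)       = refl
      selected (no y∉J∩ρ) = ⊥-elim (y∉J∩ρ (y∈J , y∈ρ))

      other-summand : ∀ x → x ≢ y → when (x ∈? J ×-dec x ∈? ρ) (G x ρ) ≈ 0#
      other-summand x x≢y = vanishes (x ∈? J ×-dec x ∈? ρ)
        where
        vanishes : (x∈J∩ρ? : Dec (x ∈ J × x ∈ ρ)) → when x∈J∩ρ? (G x ρ) ≈ 0#
        vanishes (yes (x∈J , x∈ρ)) =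
          G-chain x x∈J ρ (λ (ρ∈Δ , _) → x≢y (isolated dim0 ρ∈Δ x∈J y∈J x∈ρ y∈ρ))
        vanishes (no _) = refl

    -- Every cofacet of a face through y also contains y.
    glue-∂ : ∀ {y σ} → y ∈ J → y ∈ σ → ∂ (glue G) σ ≈ ∂ (G y) σ
    glue-∂ {y} {σ} y∈J y∈σ = ∂-local (glue G) (G y) σ (λ v _ → glue-at y∈J (∈-insert v y∈σ))

module Restriction {c ℓ : Level} (K : Field c ℓ) {n : ℕ} (Δ : SimplicialComplex n) (J : Subset n)
                   (dim0 : Dim0 Δ J) (k : ℤ) (H̃k≈0 : IsZeroSpace (Homology.H̃ K (isFace Δ) k)) where
  open Field K hiding (zero) renaming (_-_ to _⊖_)
  open Homology K
  open FiniteSums K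
  open Boundary K
  open Chains K
  open InducedSubcomplex Δ
  open Gluing K Δ J dim0
  open import Relation.Binary.Reasoning.Setoid setoid

  Δ∖J : Subset n → Bool
  Δ∖J = induced Δ (∁ J)

  Δ∖ : Fin n → Subset n → Bool
  Δ∖ x = induced Δ (∁ ⁅ x ⁆)

  k' k'' : ℤ
  k'  = k +ℤ 1ℤ
  k'' = k' +ℤ 1ℤ

  Δ∖J⊑Δ∖ : ∀ {x} → x ∈ J → Δ∖J ⊑ Δ∖ x
  Δ∖J⊑Δ∖ x∈J = induced-mono (∁-antitone x∈J)

  -- Surjectivity.  Fill each b_x in Δ by D_x and glue the D_x to S: as S = D_x
  -- near x, ∂S vanishes near J (there it equals b_x), and ∂S - b_x = ∂(S - D_x)
  -- with S - D_x a chain of Δ|_{V∖x}.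
  module Surjectivity (b : Fin n → Chain n) (b-cycle : ∀ x → x ∈ J → IsCycle (Δ∖ x) k (b x)) where

    local-filling : ∀ x → x ∈ J → Σ (Chain n) (Filling (isFace Δ) k (b x))
    local-filling x x∈J = fill k H̃k≈0 (cycle-mono k induced⇒face (b-cycle x x∈J))

    D : Fin n → Chain n
    D = choose J (λ _ → 0#) local-filling

    D-fills : ∀ x → x ∈ J → Filling (isFace Δ) k (b x) (D x)
    D-fills = choose-spec J (λ _ → 0#) local-filling

    D-chain : ∀ x → x ∈ J → IsChain (isFace Δ) k' (D x)
    D-chain x x∈J = proj₁ (D-fills x x∈J)

    S : Chain n
    S = glue D

    S-chain : IsChain (isFace Δ) k' S
    S-chain = glue-chain k' D-chain

    ∂S-near-J : ∀ σ v → v ∈ σ → v ∉ ∁ J → ∂ S σ ≈ 0#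
    ∂S-near-J σ v v∈σ v∉∁J = begin
      ∂ S σ      ≈⟨ glue-∂ k' D-chain v∈J v∈σ ⟩
      ∂ (D v) σ  ≈⟨ proj₂ (D-fills v v∈J) σ ⟩
      b v σ      ≈⟨ vanish-outside Δ k (proj₁ (b-cycle v v∈J)) v∈σ (x∉∁⁅x⁆ v) ⟩
      0#         ∎
      where
      v∈J : v ∈ J
      v∈J = x∉∁p⇒x∈p v∉∁J

    ∂S-cycle : IsCycle Δ∖J k (∂ S)
    ∂S-cycle = restrict Δ k (∂-chain Δ k S-chain) ∂S-near-J , ∂∂≈0 S

    ∂S∼b : ∀ x → x ∈ J → Homologous (Δ∖ x) k (∂ S) (b x)
    ∂S∼b x x∈J = S-Dx , restrict Δ k' (chain-sub k' S-chain (D-chain x x∈J)) S-Dx-near-x , ∂S-b≈∂[S-Dx]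
      where
      S-Dx : Chain n
      S-Dx ρ = S ρ ⊖ D x ρ

      S-Dx-near-x : ∀ ρ v → v ∈ ρ → v ∉ ∁ ⁅ x ⁆ → S-Dx ρ ≈ 0#
      S-Dx-near-x ρ v v∈ρ v∉∁⁅x⁆ with ∉∁⁅⁆ v∉∁⁅x⁆
      ... | ≡.refl = trans (⊖-cong (glue-at k' D-chain x∈J v∈ρ) refl) (x⊖x≈0 (D x ρ))

      ∂S-b≈∂[S-Dx] : ∀ σ → ∂ S σ ⊖ b x σ ≈ ∂ S-Dx σ
      ∂S-b≈∂[S-Dx] σ = sym (trans (∂-sub S (D x) σ) (⊖-cong refl (proj₂ (D-fills x x∈J) σ)))

  -- If a - a' = ∂d_y in each Δ|_{V∖y}, fill a - a' = ∂d in Δ;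
  -- each d - d_y is a (k+1)-cycle of Δ, so d - d_y = ∂e_y.  With S the glued
  -- e_y, the chain d - ∂S still bounds a - a', and near v ∈ J it equals
  -- d - ∂e_v = d_v, which vanishes there.
  module Injectivity (H̃k'≈0 : IsZeroSpace (H̃ (isFace Δ) k')) {a a' : Chain n}
                     (a-cycle : IsCycle Δ∖J k a) (a'-cycle : IsCycle Δ∖J k a')
                     (a∼a' : ∀ y → y ∈ J → Homologous (Δ∖ y) k a a') where

    w : Chain n
    w σ = a σ ⊖ a' σ

    w-cycle : IsCycle (isFace Δ) k w
    w-cycle = chain-sub k (chain-mono k induced⇒face (proj₁ a-cycle))
                          (chain-mono k induced⇒face (proj₁ a'-cycle))
            , λ τ → trans (∂-sub a a' τ) (trans (⊖-cong (proj₂ a-cycle τ) (proj₂ a'-cycle τ)) (x⊖0≈x 0#))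

    d-filling : Σ (Chain n) (Filling (isFace Δ) k w)
    d-filling = fill k H̃k≈0 w-cycle

    d : Chain n
    d = proj₁ d-filling

    d-chain : IsChain (isFace Δ) k' d
    d-chain = proj₁ (proj₂ d-filling)

    ∂d≈w : ∀ σ → ∂ d σ ≈ w σ
    ∂d≈w = proj₂ (proj₂ d-filling)

    record Correction (y : Fin n) (e : Chain n) : Set (c ⊔ ℓ) where
      field
        dy       : Chain n
        dy-chain : IsChain (Δ∖ y) k' dy
        e-fills  : Filling (isFace Δ) k' (λ σ → d σ ⊖ dy σ) e

    correct : ∀ {y} → Homologous (Δ∖ y) k a a' → Σ (Chain n) (Correction y)
    correct {y} (dy , dy-chain , w≈∂dy) =
      proj₁ e-filling , record { dy = dy ; dy-chain = dy-chain ; e-fills = proj₂ e-filling }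
      where
      d-dy-cycle : IsCycle (isFace Δ) k' (λ σ → d σ ⊖ dy σ)
      d-dy-cycle = chain-sub k' d-chain (chain-mono k' induced⇒face dy-chain)
                 , λ τ → trans (∂-sub d dy τ) (trans (⊖-cong (∂d≈w τ) (sym (w≈∂dy τ))) (x⊖x≈0 (w τ)))

      e-filling : Σ (Chain n) (Filling (isFace Δ) k' (λ σ → d σ ⊖ dy σ))
      e-filling = fill k' H̃k'≈0 d-dy-cycle

    E : Fin n → Chain n
    E = choose J (λ _ → 0#) (λ y y∈J → correct (a∼a' y y∈J))

    E-correction : ∀ y → y ∈ J → Correction y (E y)
    E-correction = choose-spec J (λ _ → 0#) (λ y y∈J → correct (a∼a' y y∈J))

    E-chain : ∀ y → y ∈ J → IsChain (isFace Δ) k'' (E y)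
    E-chain y y∈J = proj₁ (Correction.e-fills (E-correction y y∈J))

    S : Chain n
    S = glue E

    d' : Chain n
    d' σ = d σ ⊖ ∂ S σ

    w≈∂d' : ∀ σ → w σ ≈ ∂ d' σ
    w≈∂d' σ = sym (begin
      ∂ d' σ                ≈⟨ ∂-sub d (∂ S) σ ⟩
      ∂ d σ ⊖ ∂ (∂ S) σ     ≈⟨ ⊖-cong (∂d≈w σ) (∂∂≈0 S σ) ⟩
      w σ ⊖ 0#              ≈⟨ x⊖0≈x (w σ) ⟩
      w σ                   ∎)

    d'-near-J : ∀ σ v → v ∈ σ → v ∉ ∁ J → d' σ ≈ 0#
    d'-near-J σ v v∈σ v∉∁J = begin
      d σ ⊖ ∂ S σ          ≈⟨ ⊖-cong refl (glue-∂ k'' E-chain v∈J v∈σ) ⟩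
      d σ ⊖ ∂ (E v) σ      ≈⟨ ⊖-cong refl (proj₂ e-fills σ) ⟩
      d σ ⊖ (d σ ⊖ dy σ)   ≈⟨ x⊖[x⊖y]≈y (d σ) (dy σ) ⟩
      dy σ                 ≈⟨ vanish-outside Δ k' dy-chain v∈σ (x∉∁⁅x⁆ v) ⟩
      0#                   ∎
      where
      v∈J : v ∈ J
      v∈J = x∉∁p⇒x∈p v∉∁J
      open Correction (E-correction v v∈J)

    a∼a'-in-Δ∖J : Homologous Δ∖J k a a'
    a∼a'-in-Δ∖J = d' , restrict Δ k' (chain-sub k' d-chain (∂-chain Δ k' (glue-chain k'' E-chain))) d'-near-J , w≈∂d'

  restriction-iso : IsZeroSpace (H̃ (isFace Δ) k') → LinIso (H̃ Δ∖J k) (DirectSum J (λ x → H̃ (Δ∖ x) k))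
  restriction-iso H̃k'≈0 = record
    { f      = λ z x → z
    ; f-in   = λ z (lift z-cycle) x x∈J → lift (cycle-mono k (Δ∖J⊑Δ∖ x∈J) z-cycle)
    ; f-cong = λ z z' _ _ z∼z' x x∈J → homologous-mono k (Δ∖J⊑Δ∖ x∈J) z∼z'
    ; f-add  = λ z z' _ _ x _ → homologous-refl k (λ σ → z σ + z' σ)
    ; f-scal = λ s z _ x _ → homologous-refl k (λ σ → s * z σ)
    ; f-inj  = λ a a' (lift a-cycle) (lift a'-cycle) a∼a' →
                 Injectivity.a∼a'-in-Δ∖J H̃k'≈0 a-cycle a'-cycle a∼a'
    ; f-surj = λ b b-in → let open Surjectivity b (λ x x∈J → lower (b-in x x∈J))
                          in ∂ S , lift ∂S-cycle , ∂S∼b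
    }

-- Lemma 4.4: with k = i - 1 we have i = k + 1.

lemma4p4 : ∀ {c ℓ : Level} (K : Field c ℓ) {n : ℕ} (Δ : SimplicialComplex n) (J : Subset n)
    → J ⊂ ⊤ → Dim0 Δ J → (i : ℤ)
    → IsZeroSpace (Homology.H̃ K (isFace Δ) (i - 1ℤ))
    → IsZeroSpace (Homology.H̃ K (isFace Δ) i)
    → LinIso (Homology.H̃ K (induced Δ (∁ J)) (i - 1ℤ))
    (DirectSum J (λ x → Homology.H̃ K (induced Δ (∁ ⁅ x ⁆)) (i - 1ℤ)))
lemma4p4 K Δ J _ dim0 i H̃i-1≈0 H̃i≈0 =
  restriction-iso (subst (λ j → IsZeroSpace (Homology.H̃ K (isFace Δ) j)) (≡.sym (pred-suc i)) H̃i≈0)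
  where open Restriction K Δ J dim0 (i - 1ℤ) H̃i-1≈0
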